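{- For every connected chord diagram with $n$ chords, the first terminal chord in intersection order is the chord containing the point $2n$.
   Context: A chord diagram with $n$ chords is a perfect matching of $\{1,\dots,2n\}$; each pair $\{a,b\}$ with $a<b$ is a chord. The root chord is the chord containing $1$. The oriented intersection graph has a vertex per chord and an edge from $\{a,b\}$ to $\{c,d\}$ whenever $a<c<b<d$. The diagram is connected if this graph is connected (as an undirected graph); a chord is terminal if its vertex has no outgoing edge. The intersection order of the chords of a connected diagram $C$ is defined recursively: the root chord is first; removing the root chord leaves connected components $C_1,\dots,C_s$ (each regarded as a connected chord diagram, endpoints relabeled order-preservingly) ordered by their smallest endpoint; then come all chords of $C_1$ in their intersection order, then those of $C_2$, etc. -}

module Defs where

open import Data.Nat using (ℕ; suc; _*_; _<_; _≤_)
open import Data.Product using (_×_; _,_; proj₁; proj₂; ∃; ∃-syntax)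
open import Data.Sum using (_⊎_)
open import Data.List using (List; []; _∷_; _++_; concat; concatMap; map; upTo)
open import Data.List.Membership.Propositional using (_∈_)
open import Data.List.Relation.Unary.All using (All)
open import Data.List.Relation.Unary.AllPairs using (AllPairs)
open import Data.List.Relation.Binary.Pointwise using (Pointwise)
open import Data.List.Relation.Binary.Permutation.Propositional using (_↭_)
open import Relation.Nullary using (¬_)
open import Relation.Binary.PropositionalEquality using (_≡_; _≢_)

Chord : Set
Chord = ℕ × ℕ

ends : List Chord → List ℕ
ends = concatMap (λ c → proj₁ c ∷ proj₂ c ∷ [])

points : ℕ → List ℕ
points n = map suc (upTo (2 * n))

-- D is a chord diagram with n chords: a perfect matching of {1,...,2n},
-- each chord written (a , b) with a < b.
IsDiagram : ℕ → List Chord → Set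
IsDiagram n D = All (λ c → proj₁ c < proj₂ c) D × (ends D ↭ points n)

-- oriented edge {a,b} → {c,d} iff a < c < b < d
Crosses : Chord → Chord → Set
Crosses (a , b) (c , d) = a < c × c < b × b < d

Adj : Chord → Chord → Set
Adj x y = Crosses x y ⊎ Crosses y x

data Path (L : List Chord) : Chord → Chord → Set where
  here : ∀ {c} → Path L c c
  step : ∀ {c d e} → d ∈ L → Adj c d → Path L d e → Path L c e

Connected : List Chord → Set
Connected L = ∀ {c d} → c ∈ L → d ∈ L → Path L c d

Terminal : List Chord → Chord → Set
Terminal D c = ∀ {d} → d ∈ D → ¬ Crosses c d

ContainsPoint : Chord → ℕ → Set
ContainsPoint c p = proj₁ c ≡ p ⊎ proj₂ c ≡ p

IsRoot : Chord → List Chord → Set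
IsRoot r D = r ∈ D × All (λ q → proj₁ r ≤ q) (ends D)

MinBelow : List Chord → List Chord → Set
MinBelow C C' = ∃[ p ] (p ∈ ends C × All (λ q → p < q) (ends C'))

record Components (L : List Chord) (Cs : List (List Chord)) : Set where
  field
    partition : concat Cs ↭ L
    nonempty  : All (λ C → C ≢ []) Cs
    connected : All Connected Cs
    separated : AllPairs (λ C C' → ∀ {c d} → c ∈ C → d ∈ C' → ¬ Adj c d) Cs
    sorted    : AllPairs MinBelow Cs

-- IntOrder D ℓ : ℓ is the intersection order of the chords of D
-- (components are kept with their original endpoint labels; only the
-- relative order of endpoints matters, so this agrees with relabeling).
data IntOrder : List Chord → List Chord → Set where
  intOrder : ∀ {D r R Cs ℓs} →
             D ↭ r ∷ R → IsRoot r D → Components R Cs →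
             Pointwise IntOrder Cs ℓs →
             IntOrder D (r ∷ concat ℓs)

FirstTerminal : List Chord → List Chord → Chord → Set
FirstTerminal D ℓ c =
  ∃[ pre ] ∃[ post ] (ℓ ≡ pre ++ c ∷ post × All (λ x → ¬ Terminal D x) pre × Terminal D c)

module Submission where

-- Let c be the chord with the largest right end; its right end is 2n and nothing crosses out
-- of it, so it suffices that every chord listed before c crosses some chord.  By induction on
-- the intersection order: it lists the root r and then the first component C₁ of the rest.  By
-- connectedness r crosses a chord h of C₁ and a chord g of each later component C.  Both h and
-- g contain the right end of r, neither crosses the other nor shares an end with it, so one is
-- nested in the other; since C₁ has the smaller minimal endpoint, h contains g and with it all
-- of C.  Hence c is the rightmost chord of C₁, and r precedes it and crosses h.  The order
-- exists since the components of the rest can be built by inserting its chords from right to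
-- left.

open import Defs
open import Data.Nat using (ℕ; zero; suc; _*_; _≤_; _<_; _<?_)
open import Data.Nat.Properties
  using (<-cmp; <-trans; <-asym; <-irrefl; ≤-trans; ≤-refl; <⇒≤; <-≤-trans; ≤∧≢⇒<; ≤-antisym;
         ≤-pred; suc-injective; n<1+n; ≤-decTotalOrder; module ≤-Reasoning)
open import Data.Product using (_×_; _,_; proj₁; proj₂; ∃-syntax)
open import Data.Sum using (_⊎_; inj₁; inj₂; swap) renaming (map to ⊎-map)
open import Data.Empty using (⊥-elim)
open import Function using (_∘_)
open import Data.List using (List; []; _∷_; _++_; concat; foldr; filter; length)
open import Data.List.Membership.Propositional using (_∈_; _∉_; find; lose)
open import Data.List.Membership.Propositional.Properties
  using (∈-++⁻; ∈-++⁺ʳ; ∈-concat⁻′; ∈-concat⁺′; ∈-map⁺; ∈-map⁻; ∈-upTo⁺; ∈-upTo⁻; ∈-filter⁻)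
open import Data.List.Relation.Binary.Subset.Propositional using (_⊆_)
open import Data.List.Relation.Unary.Any using (Any; here; there; any?)
open import Data.List.Relation.Unary.All as All using (All; []; _∷_)
import Data.List.Relation.Unary.All.Properties as AllP
open import Data.List.Relation.Unary.AllPairs as AllPairs using (AllPairs; []; _∷_)
import Data.List.Relation.Unary.AllPairs.Properties as AllPairsP
open import Data.List.Relation.Unary.Unique.Propositional using (Unique)
import Data.List.Relation.Unary.Unique.Propositional.Properties as UniqueP
open import Data.List.Relation.Binary.Pointwise using (Pointwise; []; _∷_)
open import Data.List.Relation.Binary.Permutation.Propositional using (_↭_; ↭-sym; ↭-trans; ↭-refl; ↭-reflexive; ↭⇒↭ₛ; prep)
import Data.List.Relation.Binary.Permutation.Propositional.Properties as ↭P
import Data.List.Relation.Binary.Permutation.Setoid.Properties as ↭ₛP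
import Data.List.Properties as ListP
open import Data.List.Relation.Unary.Linked.Properties using (Linked⇒AllPairs)
import Data.List.Sort as Sort
open import Relation.Binary.Bundles using (DecTotalOrder)
import Relation.Binary.Construct.On as On
open import Relation.Binary.Definitions using (tri<; tri≈; tri>)
open import Relation.Binary.PropositionalEquality using (_≡_; _≢_; refl; sym; cong; setoid; module ≡-Reasoning)
open import Relation.Nullary using (¬_; Dec; yes; no)
open import Relation.Nullary.Decidable using (_×-dec_; _⊎-dec_)
open import Relation.Unary using (Pred; Decidable)
open import Relation.Unary.Properties using (∁?)

Oriented : List Chord → Set
Oriented D = ∀ {x} → x ∈ D → proj₁ x < proj₂ x

SharesEnd : Chord → Chord → Set
SharesEnd x y = ∃[ p ] (ContainsPoint x p × ContainsPoint y p)

record PartialMatching (D : List Chord) : Set where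
  field
    oriented     : Oriented D
    unique       : Unique D
    endsDistinct : ∀ {x y} → x ∈ D → y ∈ D → SharesEnd x y → x ≡ y

Separated : List Chord → List Chord → Set
Separated C C′ = ∀ {c d} → c ∈ C → d ∈ C′ → ¬ Adj c d

EndDisjoint : List Chord → List Chord → Set
EndDisjoint C C′ = ∀ {c d} → c ∈ C → d ∈ C′ → ¬ SharesEnd c d

SharesEnd-sym : ∀ {x y} → SharesEnd x y → SharesEnd y x
SharesEnd-sym (p , x∋p , y∋p) = p , y∋p , x∋p

Adj-sym : ∀ {x y} → Adj x y → Adj y x
Adj-sym = swap

∈-ends⁺ : ∀ {y p D} → y ∈ D → ContainsPoint y p → p ∈ ends D
∈-ends⁺ (here refl) (inj₁ refl) = here refl
∈-ends⁺ (here refl) (inj₂ refl) = there (here refl)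
∈-ends⁺ (there y∈) y∋p          = there (there (∈-ends⁺ y∈ y∋p))

∈-ends⁻ : ∀ {p} D → p ∈ ends D → ∃[ y ] (y ∈ D × ContainsPoint y p)
∈-ends⁻ (y ∷ D) (here p≡)         = y , here refl , inj₁ (sym p≡)
∈-ends⁻ (y ∷ D) (there (here p≡)) = y , here refl , inj₂ (sym p≡)
∈-ends⁻ (y ∷ D) (there (there p∈)) with ∈-ends⁻ D p∈
... | y′ , y′∈ , y′∋p = y′ , there y′∈ , y′∋p

ContainsPoint⇒proj₁≤ : ∀ {y p} → proj₁ y < proj₂ y → ContainsPoint y p → proj₁ y ≤ p
ContainsPoint⇒proj₁≤ _   (inj₁ refl) = ≤-refl
ContainsPoint⇒proj₁≤ y<y (inj₂ refl) = <⇒≤ y<y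

ContainsPoint⇒≤proj₂ : ∀ {y p} → proj₁ y < proj₂ y → ContainsPoint y p → p ≤ proj₂ y
ContainsPoint⇒≤proj₂ y<y (inj₁ refl) = <⇒≤ y<y
ContainsPoint⇒≤proj₂ _   (inj₂ refl) = ≤-refl

Path-mono : ∀ {L L′ c d} → L ⊆ L′ → Path L c d → Path L′ c d
Path-mono L⊆ here             = here
Path-mono L⊆ (step d∈ c~d p) = step (L⊆ d∈) c~d (Path-mono L⊆ p)

Path-trans : ∀ {L a b c} → Path L a b → Path L b c → Path L a c
Path-trans here             q = q
Path-trans (step d∈ a~d p) q = step d∈ a~d (Path-trans p q)

Path-sym : ∀ {L c d} → c ∈ L → Path L c d → Path L d c
Path-sym c∈ here             = here
Path-sym c∈ (step d∈ c~d p) = Path-trans (Path-sym d∈ p) (step c∈ (Adj-sym c~d) here)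

Between : ℕ → Chord → Set
Between p x = proj₁ x < p × p < proj₂ x

Nested : Chord → Chord → Set
Nested a x = proj₁ a < proj₁ x × proj₂ x < proj₂ a

Adj⇒endBetween : ∀ x z → Adj x z → Between (proj₁ z) x ⊎ Between (proj₂ z) x
Adj⇒endBetween _ _ (inj₁ (x₁<z₁ , z₁<x₂ , _)) = inj₁ (x₁<z₁ , z₁<x₂)
Adj⇒endBetween _ _ (inj₂ (_ , x₁<z₂ , z₂<x₂)) = inj₂ (x₁<z₂ , z₂<x₂)

Between-Nested : ∀ {p a x} → Between p x → Nested a x → Between p a
Between-Nested (x₁<p , p<x₂) (a₁<x₁ , x₂<a₂) = <-trans a₁<x₁ x₁<p , <-trans p<x₂ x₂<a₂

endBetween⇒Nested : ∀ a z → ¬ Adj a z → ¬ SharesEnd a z →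
                    Between (proj₁ z) a ⊎ Between (proj₂ z) a → Nested a z
endBetween⇒Nested (a₁ , a₂) (z₁ , z₂) ¬a~z ¬a≈z (inj₁ (a₁<z₁ , z₁<a₂)) with <-cmp z₂ a₂
... | tri< z₂<a₂ _ _ = a₁<z₁ , z₂<a₂
... | tri≈ _ z₂≡a₂ _ = ⊥-elim (¬a≈z (a₂ , inj₂ refl , inj₂ z₂≡a₂))
... | tri> _ _ a₂<z₂ = ⊥-elim (¬a~z (inj₁ (a₁<z₁ , z₁<a₂ , a₂<z₂)))
endBetween⇒Nested (a₁ , a₂) (z₁ , z₂) ¬a~z ¬a≈z (inj₂ (a₁<z₂ , z₂<a₂)) with <-cmp a₁ z₁
... | tri< a₁<z₁ _ _ = a₁<z₁ , z₂<a₂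
... | tri≈ _ a₁≡z₁ _ = ⊥-elim (¬a≈z (a₁ , inj₁ refl , inj₁ (sym a₁≡z₁)))
... | tri> _ _ z₁<a₁ = ⊥-elim (¬a~z (inj₂ (z₁<a₁ , a₁<z₂ , z₂<a₂)))

Nested-along : ∀ a {B x y} → (∀ {z} → z ∈ B → ¬ Adj a z) → (∀ {z} → z ∈ B → ¬ SharesEnd a z) →
               Path B x y → Nested a x → Nested a y
Nested-along a ¬a~ ¬a≈ here a⊃x = a⊃x
Nested-along a ¬a~ ¬a≈ (step {c = x} {d = z} z∈ x~z p) a⊃x =
  Nested-along a ¬a~ ¬a≈ p
    (endBetween⇒Nested a z (¬a~ z∈) (¬a≈ z∈)
      (⊎-map (λ b → Between-Nested b a⊃x) (λ b → Between-Nested b a⊃x) (Adj⇒endBetween x z x~z)))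

Between⇒Nested⊎Nested : ∀ {p} h g → Between p h → Between p g → ¬ Adj h g → ¬ SharesEnd h g →
                         Nested h g ⊎ Nested g h
Between⇒Nested⊎Nested (h₁ , h₂) (g₁ , g₂) (h₁<p , p<h₂) (g₁<p , p<g₂) ¬h~g ¬h≈g with <-cmp h₁ g₁
... | tri< h₁<g₁ _ _ =
  inj₁ (endBetween⇒Nested (h₁ , h₂) (g₁ , g₂) ¬h~g ¬h≈g (inj₁ (h₁<g₁ , <-trans g₁<p p<h₂)))
... | tri≈ _ h₁≡g₁ _ = ⊥-elim (¬h≈g (h₁ , inj₁ refl , inj₁ (sym h₁≡g₁)))
... | tri> _ _ g₁<h₁ =
  inj₂ (endBetween⇒Nested (g₁ , g₂) (h₁ , h₂) (¬h~g ∘ Adj-sym) (¬h≈g ∘ SharesEnd-sym)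
         (inj₁ (g₁<h₁ , <-trans h₁<p p<g₂)))

Crosses⇒Between : ∀ r h → Crosses r h → Between (proj₂ r) h
Crosses⇒Between _ _ (_ , h₁<r₂ , r₂<h₂) = h₁<r₂ , r₂<h₂

laterComponent-Nested : ∀ {r h g C C′} → Crosses r h → Crosses r g → h ∈ C → g ∈ C′ →
                        Oriented C → Connected C → Connected C′ →
                        Separated C C′ → EndDisjoint C C′ → MinBelow C C′ →
                        ∀ {y} → y ∈ C′ → Nested h y
laterComponent-Nested {r} {h} {g} {C} r→h r→g h∈ g∈ oriented conn conn′ sep endDisj (p , p∈ , p<C′) y∈
  with Between⇒Nested⊎Nested h g (Crosses⇒Between r h r→h) (Crosses⇒Between r g r→g)
                              (sep h∈ g∈) (endDisj h∈ g∈)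
... | inj₁ h⊃g = Nested-along h (sep h∈) (endDisj h∈) (conn′ g∈ y∈) h⊃g
... | inj₂ g⊃h with ∈-ends⁻ C p∈
...   | f , f∈ , f∋p = ⊥-elim (<-asym g₁<p p<g₁)
  where
  g⊃f : Nested g f
  g⊃f = Nested-along g (λ z∈ → sep z∈ g∈ ∘ Adj-sym) (λ z∈ → endDisj z∈ g∈ ∘ SharesEnd-sym)
                     (conn h∈ f∈) g⊃h
  g₁<p : proj₁ g < p
  g₁<p = <-≤-trans (proj₁ g⊃f) (ContainsPoint⇒proj₁≤ (oriented f∈) f∋p)
  p<g₁ : p < proj₁ g
  p<g₁ = All.lookup p<C′ (∈-ends⁺ g∈ (inj₁ refl))

Unique-resp-↭ : ∀ {A : Set} {xs ys : List A} → xs ↭ ys → Unique xs → Unique ys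
Unique-resp-↭ {A} = ↭ₛP.Unique-resp-↭ (setoid A) ∘ ↭⇒↭ₛ

Unique-++⁻ˡ : ∀ {A : Set} (xs : List A) {ys} → Unique (xs ++ ys) → Unique xs
Unique-++⁻ˡ []       _            = []
Unique-++⁻ˡ (x ∷ xs) (x∉ ∷ uniq) = AllP.++⁻ˡ xs x∉ ∷ Unique-++⁻ˡ xs uniq

Unique-++⁻ʳ : ∀ {A : Set} (xs : List A) {ys} → Unique (xs ++ ys) → Unique ys
Unique-++⁻ʳ []       uniq       = uniq
Unique-++⁻ʳ (_ ∷ xs) (_ ∷ uniq) = Unique-++⁻ʳ xs uniq

≢[]⇒∃∈ : ∀ {A : Set} {xs : List A} → xs ≢ [] → ∃[ x ] x ∈ xs
≢[]⇒∃∈ {xs = []}    xs≢[] = ⊥-elim (xs≢[] refl)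
≢[]⇒∃∈ {xs = x ∷ _} _     = x , here refl

Unique-++⇒disjoint : ∀ {A : Set} (xs : List A) {ys x} → Unique (xs ++ ys) → x ∈ xs → x ∉ ys
Unique-++⇒disjoint (x ∷ xs) (x∉ ∷ _)    (here refl) x∈ys = All.lookup x∉ (∈-++⁺ʳ xs x∈ys) refl
Unique-++⇒disjoint (_ ∷ xs) (_ ∷ uniq) (there x∈)  x∈ys = Unique-++⇒disjoint xs uniq x∈ x∈ys

Unique-concat⁻ : ∀ {A : Set} {xss : List (List A)} {xs} → Unique (concat xss) → xs ∈ xss → Unique xs
Unique-concat⁻ {xss = xs ∷ _}   uniq (here refl) = Unique-++⁻ˡ xs uniq
Unique-concat⁻ {xss = xs′ ∷ _} uniq (there xs∈) = Unique-concat⁻ (Unique-++⁻ʳ xs′ uniq) xs∈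

AllPairs-∈ : ∀ {A : Set} {R : A → A → Set} {xs a b} → AllPairs R xs → a ∈ xs → b ∈ xs →
             a ≡ b ⊎ R a b ⊎ R b a
AllPairs-∈ (_ ∷ _)     (here refl) (here refl) = inj₁ refl
AllPairs-∈ (Rx ∷ _)    (here refl) (there b∈)  = inj₂ (inj₁ (All.lookup Rx b∈))
AllPairs-∈ (Rx ∷ _)    (there a∈)  (here refl) = inj₂ (inj₂ (All.lookup Rx a∈))
AllPairs-∈ (_ ∷ pairs) (there a∈)  (there b∈)  = AllPairs-∈ pairs a∈ b∈

length-≤-concat : ∀ {A : Set} {xss : List (List A)} {xs} → xs ∈ xss → length xs ≤ length (concat xss)
length-≤-concat {xss = xs ∷ _}    (here refl) = ListP.length-++-≤ˡ xs
length-≤-concat {xss = xs′ ∷ xss} (there xs∈) =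
  ≤-trans (length-≤-concat xs∈) (ListP.length-++-≤ʳ (concat xss) {xs′})

PartialMatching-⊆ : ∀ {C D} → PartialMatching D → C ⊆ D → Unique C → PartialMatching C
PartialMatching-⊆ pm C⊆D uniq = record
  { oriented     = oriented ∘ C⊆D
  ; unique       = uniq
  ; endsDistinct = λ x∈ y∈ → endsDistinct (C⊆D x∈) (C⊆D y∈)
  }
  where open PartialMatching pm

PartialMatching-resp-↭ : ∀ {D D′} → D ↭ D′ → PartialMatching D → PartialMatching D′
PartialMatching-resp-↭ D↭ pm =
  PartialMatching-⊆ pm (↭P.∈-resp-↭ (↭-sym D↭)) (Unique-resp-↭ D↭ (PartialMatching.unique pm))

Components-closed : ∀ {L Cs C z d} → Components L Cs → C ∈ Cs → z ∈ C → d ∈ L → Adj z d → d ∈ C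
Components-closed {Cs = Cs} comps C∈ z∈ d∈ z~d
  with ∈-concat⁻′ Cs (↭P.∈-resp-↭ (↭-sym (Components.partition comps)) d∈)
... | C′ , d∈C′ , C′∈ with AllPairs-∈ (Components.separated comps) C∈ C′∈
...   | inj₁ refl        = d∈C′
...   | inj₂ (inj₁ sep) = ⊥-elim (sep z∈ d∈C′ z~d)
...   | inj₂ (inj₂ sep) = ⊥-elim (sep d∈C′ z∈ (Adj-sym z~d))

module RootDecomposition {D r R Cs} (D↭ : D ↭ r ∷ R) (root : IsRoot r D)
                         (comps : Components R Cs) (pm : PartialMatching D) where
  open Components comps public
  open PartialMatching pm

  ∈D⇒≡r⊎∈R : ∀ {y} → y ∈ D → y ≡ r ⊎ y ∈ R
  ∈D⇒≡r⊎∈R y∈ with ↭P.∈-resp-↭ D↭ y∈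
  ... | here y≡r = inj₁ y≡r
  ... | there y∈R = inj₂ y∈R

  ∈component⇒∈R : ∀ {y C} → y ∈ C → C ∈ Cs → y ∈ R
  ∈component⇒∈R y∈ C∈ = ↭P.∈-resp-↭ partition (∈-concat⁺′ y∈ C∈)

  ∈R⇒∈D : R ⊆ D
  ∈R⇒∈D y∈ = ↭P.∈-resp-↭ (↭-sym D↭) (there y∈)

  component⊆D : ∀ {C} → C ∈ Cs → C ⊆ D
  component⊆D C∈ y∈ = ∈R⇒∈D (∈component⇒∈R y∈ C∈)

  uniqueComponents : Unique (concat Cs)
  uniqueComponents = Unique-resp-↭ (↭-sym partition) (AllPairs.tail (Unique-resp-↭ D↭ unique))

  r∉R : r ∉ R
  r∉R = UniqueP.Unique[x∷xs]⇒x∉xs (Unique-resp-↭ D↭ unique)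

  component-partialMatching : ∀ {C} → C ∈ Cs → PartialMatching C
  component-partialMatching C∈ =
    PartialMatching-⊆ pm (component⊆D C∈) (Unique-concat⁻ uniqueComponents C∈)

  component-shorter : ∀ {C} → C ∈ Cs → length C < length D
  component-shorter {C} C∈ = begin-strict
    length C           ≤⟨ length-≤-concat C∈ ⟩
    length (concat Cs) ≡⟨ ↭P.↭-length partition ⟩
    length R           <⟨ n<1+n (length R) ⟩
    length (r ∷ R)     ≡⟨ ↭P.↭-length (↭-sym D↭) ⟩
    length D           ∎
    where open ≤-Reasoning

  adjacentToRoot⇒crossedByRoot : ∀ {z} → z ∈ D → Adj z r → Crosses r z
  adjacentToRoot⇒crossedByRoot z∈ (inj₁ (z₁<r₁ , _)) =
    ⊥-elim (<-irrefl refl (<-≤-trans z₁<r₁ (All.lookup (proj₂ root) (∈-ends⁺ z∈ (inj₁ refl)))))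
  adjacentToRoot⇒crossedByRoot z∈ (inj₂ r→z) = r→z

  -- The path stays inside C until it reaches r.
  path-crossedByRoot : ∀ {C z} → C ∈ Cs → z ∈ C → Path D z r → ∃[ w ] (w ∈ C × Crosses r w)
  path-crossedByRoot C∈ z∈ here = ⊥-elim (r∉R (∈component⇒∈R z∈ C∈))
  path-crossedByRoot {z = z} C∈ z∈ (step d∈ z~d d⇝r) with ∈D⇒≡r⊎∈R d∈
  ... | inj₁ refl = z , z∈ , adjacentToRoot⇒crossedByRoot (component⊆D C∈ z∈) z~d
  ... | inj₂ d∈R  = path-crossedByRoot C∈ (Components-closed comps C∈ z∈ d∈R z~d) d⇝r

  component-crossedByRoot : Connected D → ∀ {C z} → C ∈ Cs → z ∈ C → ∃[ w ] (w ∈ C × Crosses r w)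
  component-crossedByRoot conn C∈ z∈ = path-crossedByRoot C∈ z∈ (conn (component⊆D C∈ z∈) (proj₁ root))

HasOutEdge : List Chord → Chord → Set
HasOutEdge D x = ∃[ d ] (d ∈ D × Crosses x d)

HasOutEdge-mono : ∀ {C D x} → C ⊆ D → HasOutEdge C x → HasOutEdge D x
HasOutEdge-mono C⊆D (d , d∈ , x→d) = d , C⊆D d∈ , x→d

Rightmost : List Chord → Chord → Set
Rightmost D c = ∀ {y} → y ∈ D → proj₂ y ≤ proj₂ c

module FirstComponent {D r R C₁ Cs} (D↭ : D ↭ r ∷ R) (root : IsRoot r D)
                      (comps : Components R (C₁ ∷ Cs)) (pm : PartialMatching D) (conn : Connected D) where
  open RootDecomposition D↭ root comps pm public
  open PartialMatching pm using (oriented; endsDistinct)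

  C₁⊆D : C₁ ⊆ D
  C₁⊆D = component⊆D (here refl)

  crossedInC₁ : ∃[ h ] (h ∈ C₁ × Crosses r h)
  crossedInC₁ = component-crossedByRoot conn (here refl) (proj₂ (≢[]⇒∃∈ (All.head nonempty)))

  h : Chord
  h = proj₁ crossedInC₁

  h∈C₁ : h ∈ C₁
  h∈C₁ = proj₁ (proj₂ crossedInC₁)

  r→h : Crosses r h
  r→h = proj₂ (proj₂ crossedInC₁)

  root-hasOutEdge : HasOutEdge D r
  root-hasOutEdge = h , C₁⊆D h∈C₁ , r→h

  endDisjoint : ∀ {C} → C ∈ Cs → EndDisjoint C₁ C
  endDisjoint C∈ x∈ y∈ x≈y with endsDistinct (C₁⊆D x∈) (component⊆D (there C∈) y∈) x≈y
  ... | refl = Unique-++⇒disjoint C₁ uniqueComponents x∈ (∈-concat⁺′ y∈ C∈)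

  laterComponent-nestedIn-h : ∀ {C y} → C ∈ Cs → y ∈ C → Nested h y
  laterComponent-nestedIn-h C∈ y∈ with component-crossedByRoot conn (there C∈) y∈
  ... | g , g∈ , r→g =
    laterComponent-Nested r→h r→g h∈C₁ g∈ (oriented ∘ C₁⊆D)
      (All.head connected) (All.lookup connected (there C∈))
      (All.lookup (AllPairs.head separated) C∈) (endDisjoint C∈)
      (All.lookup (AllPairs.head sorted) C∈) y∈

  Rightmost-fromC₁ : ∀ {c} → Rightmost C₁ c → Rightmost D c
  Rightmost-fromC₁ c-rightmost y∈ with ∈D⇒≡r⊎∈R y∈
  ... | inj₁ refl = <⇒≤ (<-≤-trans (proj₂ (Crosses⇒Between r h r→h)) (c-rightmost h∈C₁))
  ... | inj₂ y∈R with ∈-++⁻ C₁ (↭P.∈-resp-↭ (↭-sym partition) y∈R)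
  ...   | inj₁ y∈C₁ = c-rightmost y∈C₁
  ...   | inj₂ y∈later with ∈-concat⁻′ Cs y∈later
  ...     | C , y∈C , C∈ = <⇒≤ (<-≤-trans (proj₂ (laterComponent-nestedIn-h C∈ y∈C)) (c-rightmost h∈C₁))

record RightmostSplit (D ℓ : List Chord) : Set where
  constructor rightmostSplit
  field
    chord          : Chord
    chord∈         : chord ∈ D
    rightmost      : Rightmost D chord
    before after   : List Chord
    split          : ℓ ≡ before ++ chord ∷ after
    beforeCrossing : All (HasOutEdge D) before

intOrder-rightmostSplit : ∀ {D ℓ} → IntOrder D ℓ → PartialMatching D → Connected D → RightmostSplit D ℓ
intOrder-rightmostSplit (intOrder {r = r} D↭ root comps []) pm conn =
  rightmostSplit r (proj₁ root) r-rightmost [] [] refl []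
  where
  open RootDecomposition D↭ root comps pm
  r-rightmost : Rightmost _ r
  r-rightmost y∈ with ∈D⇒≡r⊎∈R y∈
  ... | inj₁ refl = ≤-refl
  ... | inj₂ y∈R with ↭P.∈-resp-↭ (↭-sym partition) y∈R
  ... | ()
intOrder-rightmostSplit (intOrder {r = r} {ℓs = ℓ₁ ∷ ℓs} D↭ root comps (io₁ ∷ _)) pm conn =
  rightmostSplit chord (C₁⊆D chord∈) (Rightmost-fromC₁ {chord} rightmost) (r ∷ before) (after ++ concat ℓs)
                 split′ (root-hasOutEdge ∷ All.map (HasOutEdge-mono C₁⊆D) beforeCrossing)
  where
  open FirstComponent D↭ root comps pm conn
  open RightmostSplit (intOrder-rightmostSplit io₁ (component-partialMatching (here refl)) (All.head connected))
  split′ : r ∷ concat (ℓ₁ ∷ ℓs) ≡ (r ∷ before) ++ chord ∷ (after ++ concat ℓs)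
  split′ = cong (r ∷_) (begin
    ℓ₁ ++ concat ℓs                        ≡⟨ cong (_++ concat ℓs) split ⟩
    (before ++ chord ∷ after) ++ concat ℓs ≡⟨ ListP.++-assoc before (chord ∷ after) (concat ℓs) ⟩
    before ++ chord ∷ (after ++ concat ℓs) ∎)
    where open ≡-Reasoning

crosses? : ∀ x y → Dec (Crosses x y)
crosses? (a , b) (c , d) = a <? c ×-dec c <? b ×-dec b <? d

adj? : ∀ x y → Dec (Adj x y)
adj? x y = crosses? x y ⊎-dec crosses? y x

AdjacentTo : Chord → List Chord → Set
AdjacentTo x = Any (Adj x)

adjacentTo? : ∀ x → Decidable (AdjacentTo x)
adjacentTo? x = any? (adj? x)

insertChord : Chord → List (List Chord) → List (List Chord)
insertChord x Cs = (x ∷ concat (filter (adjacentTo? x) Cs)) ∷ filter (∁? (adjacentTo? x)) Cs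

-- On a list sorted by left end, foldr inserts the leftmost chord last, so the merged component
-- always has the smallest minimal endpoint and may go first.
components : List Chord → List (List Chord)
components = foldr insertChord []

concat-filter-↭ : ∀ {A : Set} {p} {P : Pred (List A) p} (P? : Decidable P) xss →
                  concat (filter P? xss) ++ concat (filter (∁? P?) xss) ↭ concat xss
concat-filter-↭ P? []         = ↭-refl
concat-filter-↭ P? (xs ∷ xss) with P? xs
... | yes _ = ↭-trans (↭-reflexive (ListP.++-assoc xs _ _)) (↭P.++⁺ˡ xs (concat-filter-↭ P? xss))
... | no  _ = ↭-trans (↭P.shifts (concat (filter P? xss)) xs) (↭P.++⁺ˡ xs (concat-filter-↭ P? xss))

LeftOf : Chord → Chord → Set
LeftOf x y = proj₁ x < proj₁ y

module _ {x xs Cs} (comps : Components xs Cs) (x-leftmost : All (LeftOf x) xs) (oriented : Oriented xs) where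
  private
    module Old = Components comps
    Joined Rest : List (List Chord)
    Joined = filter (adjacentTo? x) Cs
    Rest   = filter (∁? (adjacentTo? x)) Cs
    New : List Chord
    New = x ∷ concat Joined

  new-connected : Connected New
  new-connected u∈ v∈ = Path-trans (Path-sym (here refl) (fromX u∈)) (fromX v∈)
    where
    fromX : ∀ {u} → u ∈ New → Path New x u
    fromX (here refl) = here
    fromX (there u∈) with ∈-concat⁻′ Joined u∈
    ... | C , u∈C , C∈ with ∈-filter⁻ (adjacentTo? x) C∈
    ...   | C∈Cs , x~C with find x~C
    ...     | w , w∈C , x~w = step (C⊆New w∈C) x~w (Path-mono C⊆New (All.lookup Old.connected C∈Cs w∈C u∈C))
      where
      C⊆New : C ⊆ New
      C⊆New v∈ = there (∈-concat⁺′ v∈ C∈)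

  new-separated-rest : All (Separated New) Rest
  new-separated-rest = All.tabulate (λ C′∈ → separated (∈-filter⁻ (∁? (adjacentTo? x)) C′∈))
    where
    separated : ∀ {C′} → C′ ∈ Cs × ¬ AdjacentTo x C′ → Separated New C′
    separated (_ , ¬x~C′) (here refl) d∈ x~d = ¬x~C′ (lose d∈ x~d)
    separated {C′} (C′∈ , ¬x~C′) (there c∈) d∈ c~d with ∈-concat⁻′ Joined c∈
    ... | C , c∈C , C∈ with ∈-filter⁻ (adjacentTo? x) C∈
    ...   | C∈Cs , x~C with AllPairs-∈ Old.separated C∈Cs C′∈
    ...     | inj₁ refl        = ¬x~C′ x~C
    ...     | inj₂ (inj₁ sep) = sep c∈C d∈ c~d
    ...     | inj₂ (inj₂ sep) = sep d∈ c∈C (Adj-sym c~d)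

  new-minBelow-rest : All (MinBelow New) Rest
  new-minBelow-rest = All.tabulate (λ C′∈ → proj₁ x , here refl ,
                 All.tabulate (x₁<ends (proj₁ (∈-filter⁻ (∁? (adjacentTo? x)) C′∈))))
    where
    x₁<ends : ∀ {C′ q} → C′ ∈ Cs → q ∈ ends C′ → proj₁ x < q
    x₁<ends {C′} C′∈ q∈ with ∈-ends⁻ C′ q∈
    ... | y , y∈ , y∋q with ↭P.∈-resp-↭ Old.partition (∈-concat⁺′ y∈ C′∈)
    ...   | y∈xs = <-≤-trans (All.lookup x-leftmost y∈xs) (ContainsPoint⇒proj₁≤ (oriented y∈xs) y∋q)

  insertChord-components : Components (x ∷ xs) (insertChord x Cs)
  insertChord-components = record
    { partition = prep x (↭-trans (concat-filter-↭ (adjacentTo? x) Cs) Old.partition)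
    ; nonempty  = (λ ()) ∷ AllP.filter⁺ (∁? (adjacentTo? x)) Old.nonempty
    ; connected = new-connected ∷ AllP.filter⁺ (∁? (adjacentTo? x)) Old.connected
    ; separated = new-separated-rest ∷ AllPairsP.filter⁺ (∁? (adjacentTo? x)) Old.separated
    ; sorted    = new-minBelow-rest ∷ AllPairsP.filter⁺ (∁? (adjacentTo? x)) Old.sorted
    }

components-correct : ∀ xs → AllPairs LeftOf xs → Oriented xs → Components xs (components xs)
components-correct []       []                  _        =
  record { partition = ↭-refl ; nonempty = [] ; connected = [] ; separated = [] ; sorted = [] }
components-correct (x ∷ xs) (x-leftmost ∷ sorted) oriented =
  insertChord-components (components-correct xs sorted (oriented ∘ there)) x-leftmost (oriented ∘ there)

byLeftEnd : DecTotalOrder _ _ _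
byLeftEnd = On.decTotalOrder ≤-decTotalOrder (proj₁ {B = λ _ → ℕ})

open Sort byLeftEnd using (sort; sort-↭; sort-↗)

sorted⇒LeftOf : ∀ {xs} → AllPairs (λ x y → proj₁ x ≤ proj₁ y) xs → PartialMatching xs → AllPairs LeftOf xs
sorted⇒LeftOf []                pm = []
sorted⇒LeftOf {x ∷ xs} (x≤ ∷ sorted) pm =
  All.tabulate x< ∷ sorted⇒LeftOf sorted (PartialMatching-⊆ pm there (AllPairs.tail unique))
  where
  open PartialMatching pm
  x< : ∀ {y} → y ∈ xs → LeftOf x y
  x< y∈ = ≤∧≢⇒< (All.lookup x≤ y∈) λ x₁≡y₁ →
    All.lookup (AllPairs.head unique) y∈ (endsDistinct (here refl) (there y∈) (proj₁ x , inj₁ refl , inj₁ (sym x₁≡y₁)))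

sortedHead-isRoot : ∀ {D r R} → D ↭ r ∷ R → All (λ y → proj₁ r ≤ proj₁ y) R → Oriented D → IsRoot r D
sortedHead-isRoot {D} {r} {R} D↭ r≤R oriented = ↭P.∈-resp-↭ (↭-sym D↭) (here refl) , All.tabulate r≤ends
  where
  r≤ : ∀ {y} → y ∈ r ∷ R → proj₁ r ≤ proj₁ y
  r≤ (here refl) = ≤-refl
  r≤ (there y∈)  = All.lookup r≤R y∈
  r≤ends : ∀ {q} → q ∈ ends D → proj₁ r ≤ q
  r≤ends q∈ with ∈-ends⁻ D q∈
  ... | y , y∈ , y∋q = ≤-trans (r≤ (↭P.∈-resp-↭ D↭ y∈)) (ContainsPoint⇒proj₁≤ (oriented y∈) y∋q)

Fits : ℕ → List Chord → Set
Fits fuel C = length C ≤ fuel × C ≢ [] × PartialMatching C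

mutual
  intOrder-exists : ∀ fuel D → length D ≤ fuel → D ≢ [] → PartialMatching D → ∃[ ℓ ] IntOrder D ℓ
  intOrder-exists zero       []      _  D≢[] _  = ⊥-elim (D≢[] refl)
  intOrder-exists (suc fuel) D       len D≢[] pm with sort D | sort-↭ D | sort-↗ D
  ... | []    | []↭D | _        = ⊥-elim (D≢[] (↭P.↭-empty-inv (↭-sym []↭D)))
  ... | r ∷ R | s↭D  | s-sorted = r ∷ concat (proj₁ orders) , intOrder D↭ root comps (proj₂ orders)
    where
    D↭ : D ↭ r ∷ R
    D↭ = ↭-sym s↭D
    pm′ : PartialMatching (r ∷ R)
    pm′ = PartialMatching-resp-↭ D↭ pm
    byLeft : AllPairs (λ x y → proj₁ x ≤ proj₁ y) (r ∷ R)
    byLeft = Linked⇒AllPairs ≤-trans s-sorted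
    root : IsRoot r D
    root = sortedHead-isRoot D↭ (AllPairs.head byLeft) (PartialMatching.oriented pm)
    comps : Components R (components R)
    comps = components-correct R (AllPairs.tail (sorted⇒LeftOf byLeft pm′)) (PartialMatching.oriented pm′ ∘ there)
    open RootDecomposition D↭ root comps pm
    component-fits : ∀ {C} → C ∈ components R → Fits fuel C
    component-fits C∈ =
      ≤-pred (<-≤-trans (component-shorter C∈) len) , All.lookup nonempty C∈ , component-partialMatching C∈
    orders : ∃[ ℓs ] Pointwise IntOrder (components R) ℓs
    orders = intOrders-exist fuel (components R) (All.tabulate component-fits)

  intOrders-exist : ∀ fuel Cs → All (Fits fuel) Cs → ∃[ ℓs ] Pointwise IntOrder Cs ℓs
  intOrders-exist fuel []       []                           = [] , []
  intOrders-exist fuel (C ∷ Cs) ((len , C≢[] , pm) ∷ fits)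
    with intOrder-exists fuel C len C≢[] pm | intOrders-exist fuel Cs fits
  ... | ℓ , io | ℓs , ios = ℓ ∷ ℓs , io ∷ ios

headEnds-noSharedEnd : ∀ {x D y} → Unique (ends (x ∷ D)) → y ∈ D → ¬ SharesEnd x y
headEnds-noSharedEnd (x₁∉ ∷ _)       y∈ (_ , inj₁ refl , y∋p) = All.lookup x₁∉ (there (∈-ends⁺ y∈ y∋p)) refl
headEnds-noSharedEnd (_ ∷ x₂∉ ∷ _) y∈ (_ , inj₂ refl , y∋p) = All.lookup x₂∉ (∈-ends⁺ y∈ y∋p) refl

uniqueEnds⇒Unique : ∀ D → Unique (ends D) → Unique D
uniqueEnds⇒Unique []      _                 = []
uniqueEnds⇒Unique (x ∷ D) uniq@(_ ∷ _ ∷ uniq′) =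
  All.tabulate (λ y∈ x≡y → headEnds-noSharedEnd uniq y∈ (proj₁ x , inj₁ refl , inj₁ (cong proj₁ (sym x≡y))))
  ∷ uniqueEnds⇒Unique D uniq′

uniqueEnds⇒endsDistinct : ∀ D → Unique (ends D) → ∀ {x y} → x ∈ D → y ∈ D → SharesEnd x y → x ≡ y
uniqueEnds⇒endsDistinct (_ ∷ _) _    (here refl) (here refl) _   = refl
uniqueEnds⇒endsDistinct (_ ∷ _) uniq (here refl) (there y∈)  x≈y = ⊥-elim (headEnds-noSharedEnd uniq y∈ x≈y)
uniqueEnds⇒endsDistinct (_ ∷ _) uniq (there x∈)  (here refl) x≈y =
  ⊥-elim (headEnds-noSharedEnd uniq x∈ (SharesEnd-sym x≈y))
uniqueEnds⇒endsDistinct (_ ∷ D) (_ ∷ _ ∷ uniq) (there x∈) (there y∈) x≈y = uniqueEnds⇒endsDistinct D uniq x∈ y∈ x≈y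

diagram⇒PartialMatching : ∀ {n D} → IsDiagram n D → PartialMatching D
diagram⇒PartialMatching {n} {D} (oriented , ends↭) = record
  { oriented     = All.lookup oriented
  ; unique       = uniqueEnds⇒Unique D uniqueEnds
  ; endsDistinct = uniqueEnds⇒endsDistinct D uniqueEnds
  }
  where
  uniqueEnds : Unique (ends D)
  uniqueEnds = Unique-resp-↭ (↭-sym ends↭) (UniqueP.map⁺ suc-injective (UniqueP.upTo⁺ (2 * n)))

∈points⇒≤ : ∀ {n p} → p ∈ points n → p ≤ 2 * n
∈points⇒≤ p∈ with ∈-map⁻ suc p∈
... | _ , i∈ , refl = ∈-upTo⁻ i∈

max∈points : ∀ m → 2 * suc m ∈ points (suc m)
max∈points m = ∈-map⁺ suc (∈-upTo⁺ (n<1+n _))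

diagram-nonempty : ∀ {m D} → IsDiagram (suc m) D → D ≢ []
diagram-nonempty {m} (_ , ends↭) refl with ↭P.∈-resp-↭ (↭-sym ends↭) (max∈points m)
... | ()

Rightmost⇒proj₂≡max : ∀ {m D c} → IsDiagram (suc m) D → c ∈ D → Rightmost D c → proj₂ c ≡ 2 * suc m
Rightmost⇒proj₂≡max {m} {D} {c} (oriented , ends↭) c∈ rightmost =
  ≤-antisym (∈points⇒≤ {suc m} (↭P.∈-resp-↭ ends↭ (∈-ends⁺ c∈ (inj₂ refl)))) max≤c₂
  where
  max≤c₂ : 2 * suc m ≤ proj₂ c
  max≤c₂ with ∈-ends⁻ D (↭P.∈-resp-↭ (↭-sym ends↭) (max∈points m))
  ... | y , y∈ , y∋max = ≤-trans (ContainsPoint⇒≤proj₂ (All.lookup oriented y∈) y∋max) (rightmost y∈)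

HasOutEdge⇒¬Terminal : ∀ {D x} → HasOutEdge D x → ¬ Terminal D x
HasOutEdge⇒¬Terminal (_ , d∈ , x→d) terminal = terminal d∈ x→d

Rightmost⇒Terminal : ∀ {D c} → Rightmost D c → Terminal D c
Rightmost⇒Terminal rightmost d∈ (_ , _ , c₂<d₂) = <-irrefl refl (<-≤-trans c₂<d₂ (rightmost d∈))

proposition4p7 : (n : ℕ) (D : List Chord) → 1 ≤ n → IsDiagram n D → Connected D →
    (∃[ ℓ ] IntOrder D ℓ) ×
    (∀ ℓ → IntOrder D ℓ → ∃[ c ] (FirstTerminal D ℓ c × ContainsPoint c (2 * n)))
proposition4p7 zero    D () _ _
proposition4p7 (suc m) D _ diagram conn =
  intOrder-exists (length D) D ≤-refl (diagram-nonempty {m} diagram) pm , firstTerminal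
  where
  pm : PartialMatching D
  pm = diagram⇒PartialMatching {suc m} diagram
  firstTerminal : ∀ ℓ → IntOrder D ℓ → ∃[ c ] (FirstTerminal D ℓ c × ContainsPoint c (2 * suc m))
  firstTerminal ℓ io =
    chord , (before , after , split , All.map HasOutEdge⇒¬Terminal beforeCrossing , Rightmost⇒Terminal rightmost) ,
    inj₂ (Rightmost⇒proj₂≡max diagram chord∈ rightmost)
    where open RightmostSplit (intOrder-rightmostSplit io pm conn)
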